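{- Let $n \ge 2$ and let $G$ be a multigraph on $n$ vertices whose edges are colored with $n-1$ colors so that each color class is a spanning star of $G$, all $n-1$ of these monochromatic stars sharing the same center. Then the number of (unordered) collections of $n-1$ pairwise edge-disjoint rainbow spanning stars in $G$ equals \[\Omega(n) = \frac{L_{n-1}}{(n-1)!},\] where $L_{n-1}$ denotes the number of Latin squares of order $n-1$.
   Context: A star is a set of edges forming a tree in which one vertex (the center) is incident to every edge; it is spanning if every vertex of $G$ is incident to one of its edges. A subgraph is rainbow if all its edges have distinct colors. Parallel edges are distinct edges, distinguished by their colors. A Latin square of order $m$ is an $m\times m$ array with entries in an $m$-element set such that each entry occurs exactly once in each row and each column. -}

module Defs where

open import Data.Nat using (ℕ; _∸_)
open import Data.Bool using (Bool; true; false)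
open import Data.Fin using (Fin; _≟_)
open import Data.Fin.Subset using (Subset; _∈_)
open import Data.Vec using (Vec; []; _∷_; lookup; tabulate)
open import Data.List using (List; length)
open import Data.List.Relation.Unary.All using (All)
open import Data.List.Relation.Unary.Linked using (Linked)
open import Data.List.Relation.Unary.AllPairs using (AllPairs)
open import Data.Product using (Σ; ∃; ∃-syntax; ∃!; _×_; proj₁; proj₂; swap)
open import Data.Sum using (_⊎_)
open import Relation.Nullary using (¬_)
open import Relation.Nullary.Decidable using (⌊_⌋)
open import Relation.Binary.PropositionalEquality using (_≡_)

-- A multigraph on the vertex set Fin n: finitely many edges (indexed by
-- Fin edges), each with two endpoints.  Parallel edges are allowed
-- (distinct indices with the same endpoints).
record Multigraph (n : ℕ) : Set where
  field
    edges : ℕ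
    ends  : Fin edges → Fin n × Fin n

open Multigraph public

module _ {n : ℕ} (G : Multigraph n) where

  Incident : Fin n → Fin (edges G) → Set
  Incident v e = proj₁ (ends G e) ≡ v ⊎ proj₂ (ends G e) ≡ v

  Loop : Fin (edges G) → Set
  Loop e = proj₁ (ends G e) ≡ proj₂ (ends G e)

  SameEnds : Fin (edges G) → Fin (edges G) → Set
  SameEnds e e' = ends G e ≡ ends G e' ⊎ ends G e ≡ swap (ends G e')

  -- S is a star with center c: a tree in which c is incident to every
  -- edge, i.e. every edge of S is a non-loop edge at c, and no two
  -- distinct edges of S join the same pair of vertices (no cycles).
  StarAt : Subset (edges G) → Fin n → Set
  StarAt S c =
    (∀ e → e ∈ S → Incident c e × ¬ Loop e) ×
    (∀ e e' → e ∈ S → e' ∈ S → SameEnds e e' → e ≡ e')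

  IsStar : Subset (edges G) → Set
  IsStar S = ∃[ c ] StarAt S c

  Spanning : Subset (edges G) → Set
  Spanning S = ∀ v → ∃[ e ] (e ∈ S × Incident v e)

  module _ {k : ℕ} (col : Fin (edges G) → Fin k) where

    Rainbow : Subset (edges G) → Set
    Rainbow S = ∀ e e' → e ∈ S → e' ∈ S → col e ≡ col e' → e ≡ e'

    ColorClass : Fin k → Subset (edges G)
    ColorClass i = tabulate (λ e → ⌊ col e ≟ i ⌋)

    MonoStarsCommonCenter : Set
    MonoStarsCommonCenter =
      ∃[ c ] (∀ i → StarAt (ColorClass i) c × Spanning (ColorClass i))

    RainbowSpanningStar : Subset (edges G) → Set
    RainbowSpanningStar S = IsStar S × Spanning S × Rainbow S

Disjoint : ∀ {m} → Subset m → Subset m → Set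
Disjoint {m} S T = ∀ (e : Fin m) → e ∈ S → e ∈ T → Data.Empty.⊥
  where import Data.Empty

-- strict lexicographic order on edge subsets (false < true); used only to
-- give each unordered collection a unique (sorted) list representation
data _<ˡ_ : ∀ {m} → Subset m → Subset m → Set where
  here  : ∀ {m} {xs ys : Subset m} → (false ∷ xs) <ˡ (true ∷ ys)
  there : ∀ {m} {b} {xs ys : Subset m} → xs <ˡ ys → (b ∷ xs) <ˡ (b ∷ ys)

-- An unordered collection of n-1 pairwise edge-disjoint rainbow spanning
-- stars of G, represented as a finite set of edge subsets, i.e. a strictly
-- sorted list (proofs are irrelevant, so two collections are equal iff
-- their sets of stars coincide).
record RainbowStarCollection {n : ℕ} (G : Multigraph n)
         (col : Fin (edges G) → Fin (n ∸ 1)) : Set where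
  field
    stars     : List (Subset (edges G))
    .sorted   : Linked _<ˡ_ stars
    .size     : length stars ≡ n ∸ 1
    .rainbow  : All (RainbowSpanningStar G col) stars
    .disjoint : AllPairs Disjoint stars

IsLatin : ∀ {m} → Vec (Vec (Fin m) m) m → Set
IsLatin {m} M =
  (∀ (i s : Fin m) → ∃! _≡_ (λ j → lookup (lookup M i) j ≡ s)) ×
  (∀ (j s : Fin m) → ∃! _≡_ (λ i → lookup (lookup M i) j ≡ s))

record LatinSquare (m : ℕ) : Set where
  field
    entries : Vec (Vec (Fin m) m) m
    .latin  : IsLatin entries

{-# OPTIONS --safe #-}
-- Every edge of G joins the common center c to a leaf, and the hypotheses on the
-- colour classes say exactly that an edge is determined by its colour and its
-- leaf, and that every (colour, leaf) pair occurs: G is the star K_{1,n-1} with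
-- each edge replaced by n-1 parallel edges of distinct colours.  A rainbow
-- spanning star therefore has one edge at every leaf j, of colour ρ j say, with
-- ρ a permutation of the colours; two such stars are edge-disjoint iff their
-- permutations differ at every leaf.  Hence the ordered families of n-1 pairwise
-- edge-disjoint rainbow spanning stars are exactly the Latin squares of order
-- n-1 (the permutations being the rows), and since the stars of such a family
-- are distinct, each unordered collection is obtained from (n-1)! families:
-- a family is its collection, kept as a strictly sorted list, together with
-- the rank of each of its members in that list, an injection Fin (n-1) → Fin (n-1).
module Submission where

open import Defs
open import Level using (0ℓ; Level)
open import Data.Bool using (true; false)
import Data.Bool.Properties as Boolₚ
open import Data.Nat using (ℕ; zero; suc; _≤_; _∸_; _*_; _!; s≤s; z≤n)
open import Data.Nat.Properties using (1+n≰n)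
open import Data.Fin using (Fin; zero; suc; _≟_; punchIn; punchOut; cast)
open import Data.Fin.Permutation using (↔⇒≡)
open import Data.Fin.Properties
  using (punchInᵢ≢i; punchIn-injective; punchOut-injective; punchOut-cong; punchOut-punchIn;
         punchIn-punchOut; suc-injective; 0≢1+n; injective⇒≤; any?; *↔×; cast-involutive)
open import Data.Fin.Subset using (Subset; _∈_)
open import Data.Fin.Subset.Properties using (_∈?_; ⊆-antisym)
open import Data.List as List using (List; length)
import Data.List.Properties as Listₚ
open import Data.List.Membership.Propositional using () renaming (_∈_ to _∈ˡ_)
open import Data.List.Membership.Propositional.Properties
  using (∈-lookup; ∈-AllPairs₂; ∈-tabulate⁺; ∈-tabulate⁻)
open import Data.List.Membership.Propositional.Properties.WithK using (unique∧set⇒bag)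
open import Data.List.Relation.Binary.BagAndSetEquality using (_∼[_]_; set; ∼bag⇒↭)
open import Data.List.Relation.Binary.Equality.Propositional using (≋⇒≡)
open import Data.List.Relation.Binary.Permutation.Propositional using (_↭_; ↭-sym; ↭⇒↭ₛ)
open import Data.List.Relation.Binary.Permutation.Propositional.Properties
  using (∈-resp-↭; ↭-length; All-resp-↭)
open import Data.List.Relation.Unary.All as All using (All)
import Data.List.Relation.Unary.All.Properties as Allₚ
open import Data.List.Relation.Unary.AllPairs as AllPairs using (AllPairs)
import Data.List.Relation.Unary.AllPairs.Properties as AllPairsₚ
open import Data.List.Relation.Unary.Any using (index)
open import Data.List.Relation.Unary.Any.Properties using (lookup-index)
open import Data.List.Relation.Unary.Linked as Linked using (Linked; []; [-]; _∷_)
open import Data.List.Relation.Unary.Linked.Properties using (Linked⇒AllPairs)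
open import Data.List.Relation.Unary.Unique.Propositional using (Unique)
import Data.List.Relation.Unary.Unique.Propositional.Properties as Uniqueₚ
open import Data.Vec using (Vec; []; _∷_; lookup; tabulate)
import Data.Vec.Properties as Vecₚ
open import Data.Vec.Properties
  using (lookup∘tabulate; tabulate∘lookup; tabulate-cong; ∷-injectiveʳ; []=⇒lookup; lookup⇒[]=)
open import Data.Product using (∃; ∃!; ∃-syntax; _×_; _,_; proj₁; proj₂; swap)
open import Data.Product.Function.NonDependent.Propositional using (_×-↔_)
open import Data.Sum using (_⊎_; inj₁; inj₂)
open import Function using (_∘_)
open import Function.Bundles using (_↔_; mk↔ₛ′; mk⇔)
open import Function.Definitions using (Injective)
open import Function.Properties.Inverse using (↔-trans; ↔-sym; ↔-refl)
open import Function.Related.Propositional using (module EquationalReasoning)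
open import Relation.Nullary using (¬_; yes; no; contradiction; recompute; ¬?)
open import Relation.Nullary.Decidable using (⌊_⌋; _×-dec_)
open import Relation.Unary using (Pred; Decidable)
open import Relation.Binary
  using (Rel; Symmetric; Trichotomous; Tri; tri<; tri≈; tri>; IsStrictTotalOrder; StrictTotalOrder)
open import Relation.Binary.PropositionalEquality
  using (_≡_; _≢_; _≗_; refl; sym; trans; cong; cong₂; subst; subst₂; setoid; isEquivalence; resp₂;
         module ≡-Reasoning)

private
  variable
    ℓ : Level
    A : Set
    a b k n : ℕ

tabulate-≗⇒≡ : ∀ (v : Vec A n) {f : Fin n → A} → f ≗ lookup v → tabulate f ≡ v
tabulate-≗⇒≡ v f≗v = trans (tabulate-cong f≗v) (tabulate∘lookup v)

lookup-tabulate-injective : ∀ {f : Fin n → A} → Injective _≡_ _≡_ f → Injective _≡_ _≡_ (lookup (tabulate f))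
lookup-tabulate-injective {f = f} f-injective {i} {j} eq =
  f-injective (trans (sym (lookup∘tabulate f i)) (trans eq (lookup∘tabulate f j)))

injective⇒surjective : ∀ {f : Fin n → Fin n} → Injective _≡_ _≡_ f → ∀ y → ∃ λ x → f x ≡ y
injective⇒surjective {zero}  _ ()
injective⇒surjective {suc _} {f} f-injective y with any? (λ x → f x ≟ y)
... | yes hit = hit
... | no miss = contradiction (injective⇒≤ avoid-injective) 1+n≰n
  where
  y≢f : ∀ x → y ≢ f x
  y≢f x y≡fx = miss (x , sym y≡fx)
  avoid-injective : Injective _≡_ _≡_ (λ x → punchOut (y≢f x))
  avoid-injective {x} {x′} = f-injective ∘ punchOut-injective (y≢f x) (y≢f x′)

injective⇒∃! : ∀ {f : Fin n → Fin n} → Injective _≡_ _≡_ f → ∀ s → ∃! _≡_ (λ j → f j ≡ s)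
injective⇒∃! f-injective s with j , fj≡s ← injective⇒surjective f-injective s =
  j , fj≡s , λ fj′≡s → f-injective (trans fj≡s (sym fj′≡s))

∃!⇒injective : ∀ {f : Fin n → Fin n} → (∀ s → ∃! _≡_ (λ j → f j ≡ s)) → Injective _≡_ _≡_ f
∃!⇒injective {f = f} unique {j} {j′} eq with _ , _ , the ← unique (f j) = trans (sym (the refl)) (the (sym eq))

record FinInjection (a b : ℕ) : Set where
  constructor mkFinInjection
  field
    table      : Vec (Fin b) a
    .injective : Injective _≡_ _≡_ (lookup table)

open FinInjection

FinInjection-≡ : {f g : FinInjection a b} → table f ≡ table g → f ≡ g
FinInjection-≡ refl = refl

FinInjection-suc↔ : FinInjection (suc a) (suc b) ↔ (Fin (suc b) × FinInjection a b)
FinInjection-suc↔ {a} {b} = mk↔ₛ′ split join split∘join join∘split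
  where
  split : FinInjection (suc a) (suc b) → Fin (suc b) × FinInjection a b
  split (mkFinInjection (x ∷ w) inj) = x , mkFinInjection (tabulate closeGap) (closeGap-injective inj)
    where
    x≢w : ∀ i → x ≢ lookup w i
    x≢w i = recompute (¬? (x ≟ lookup w i)) (λ x≡wi → 0≢1+n (inj x≡wi))
    closeGap : Fin a → Fin b
    closeGap i = punchOut (x≢w i)
    closeGap-injective : Injective _≡_ _≡_ (lookup (x ∷ w)) → Injective _≡_ _≡_ (lookup (tabulate closeGap))
    closeGap-injective inj = lookup-tabulate-injective λ {i} {j} →
      suc-injective ∘ inj ∘ punchOut-injective (x≢w i) (x≢w j)

  join : Fin (suc b) × FinInjection a b → FinInjection (suc a) (suc b)
  join (x , mkFinInjection v inj) = mkFinInjection (x ∷ tabulate (punchIn x ∘ lookup v)) (openGap-injective inj)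
    where
    openGap-injective : Injective _≡_ _≡_ (lookup v) →
                        Injective _≡_ _≡_ (lookup (x ∷ tabulate (punchIn x ∘ lookup v)))
    openGap-injective inj {zero}  {zero}  _  = refl
    openGap-injective inj {zero}  {suc j} eq =
      contradiction (sym (trans eq (lookup∘tabulate _ j))) (punchInᵢ≢i x _)
    openGap-injective inj {suc i} {zero}  eq =
      contradiction (trans (sym (lookup∘tabulate _ i)) eq) (punchInᵢ≢i x _)
    openGap-injective inj {suc i} {suc j} eq = cong suc (inj (punchIn-injective x _ _
      (trans (sym (lookup∘tabulate _ i)) (trans eq (lookup∘tabulate _ j)))))

  split∘join : ∀ p → split (join p) ≡ p
  split∘join (x , mkFinInjection v _) = cong (x ,_) (FinInjection-≡ (tabulate-≗⇒≡ v λ i →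
    trans (punchOut-cong x (lookup∘tabulate (punchIn x ∘ lookup v) i)) (punchOut-punchIn x)))

  join∘split : ∀ f → join (split f) ≡ f
  join∘split (mkFinInjection (x ∷ w) _) = FinInjection-≡ (cong (x ∷_) (tabulate-≗⇒≡ w λ i →
    trans (cong (punchIn x) (lookup∘tabulate _ i)) (punchIn-punchOut _)))

FinInjection↔Fin[n!] : ∀ n → FinInjection n n ↔ Fin (n !)
FinInjection↔Fin[n!] zero = mk↔ₛ′ (λ _ → zero) (λ _ → mkFinInjection [] λ {})
  (λ { zero → refl }) (λ { (mkFinInjection [] _) → refl })
FinInjection↔Fin[n!] (suc n) =
  ↔-trans FinInjection-suc↔ (↔-trans (↔-refl ×-↔ FinInjection↔Fin[n!] n) (↔-sym *↔×))

unique⇒lookup-injective : ∀ {xs : List A} → Unique xs → Injective _≡_ _≡_ (List.lookup xs)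
unique⇒lookup-injective (x∉xs AllPairs.∷ xs!) {zero}  {zero}  _  = refl
unique⇒lookup-injective (x∉xs AllPairs.∷ xs!) {zero}  {suc j} eq = contradiction eq (All.lookup x∉xs (∈-lookup j))
unique⇒lookup-injective (x∉xs AllPairs.∷ xs!) {suc i} {zero}  eq =
  contradiction (sym eq) (All.lookup x∉xs (∈-lookup i))
unique⇒lookup-injective (x∉xs AllPairs.∷ xs!) {suc i} {suc j} eq = cong suc (unique⇒lookup-injective xs! eq)

module SortedLists {_<_ : Rel A 0ℓ} (<-isStrictTotalOrder : IsStrictTotalOrder _≡_ _<_) where

  open IsStrictTotalOrder <-isStrictTotalOrder using (irrefl) renaming (trans to <-trans; _≟_ to _≟ᴬ_)

  private
    strictTotalOrder : StrictTotalOrder 0ℓ 0ℓ 0ℓ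
    strictTotalOrder = record { isStrictTotalOrder = <-isStrictTotalOrder }

  open import Relation.Binary.Properties.StrictTotalOrder strictTotalOrder using (decTotalOrder; totalOrder)
  open import Data.List.Sort decTotalOrder using (sort; sort-↭; sort-↗)
  open import Data.List.Relation.Unary.Sorted.TotalOrder totalOrder using (Sorted)
  open import Data.List.Relation.Unary.Sorted.TotalOrder.Properties using (↗↭↗⇒≋)
  open import Data.List.Relation.Binary.Permutation.Setoid.Properties (setoid A)
    using (Unique-resp-↭; AllPairs-resp-↭)

  StrictlySorted : List A → Set
  StrictlySorted = Linked _<_

  strictlySorted⇒sorted : ∀ {xs} → StrictlySorted xs → Sorted xs
  strictlySorted⇒sorted = Linked.map inj₁

  strictlySorted⇒unique : ∀ {xs} → StrictlySorted xs → Unique xs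
  strictlySorted⇒unique xs↗ = AllPairs.map (λ x<y x≡y → irrefl x≡y x<y) (Linked⇒AllPairs <-trans xs↗)

  sorted∧unique⇒strictlySorted : ∀ {xs} → Sorted xs → Unique xs → StrictlySorted xs
  sorted∧unique⇒strictlySorted []                _                        = []
  sorted∧unique⇒strictlySorted [-]               _                        = [-]
  sorted∧unique⇒strictlySorted (inj₁ x<y ∷ xs↗) (_ AllPairs.∷ xs!)         =
    x<y ∷ sorted∧unique⇒strictlySorted xs↗ xs!
  sorted∧unique⇒strictlySorted (inj₂ x≡y ∷ xs↗) ((x≢y All.∷ _) AllPairs.∷ _) = contradiction x≡y x≢y

  sort-strictlySorted : ∀ {xs} → Unique xs → StrictlySorted (sort xs)
  sort-strictlySorted {xs} xs! =
    sorted∧unique⇒strictlySorted (sort-↗ xs) (Unique-resp-↭ (↭⇒↭ₛ (↭-sym (sort-↭ xs))) xs!)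

  -- Without repetitions, equal sets are equal bags, i.e. permutations of each
  -- other, and a sorted permutation is unique.
  strictlySorted-set-≡ : ∀ {xs ys} → StrictlySorted xs → StrictlySorted ys → xs ∼[ set ] ys → xs ≡ ys
  strictlySorted-set-≡ xs↗ ys↗ xs∼ys = ≋⇒≡ (↗↭↗⇒≋ totalOrder (strictlySorted⇒sorted xs↗) (strictlySorted⇒sorted ys↗)
    (↭⇒↭ₛ (∼bag⇒↭ (unique∧set⇒bag (strictlySorted⇒unique xs↗) (strictlySorted⇒unique ys↗) xs∼ys))))

  module Unlabelling (P : A → Set) (R : Rel A 0ℓ) (R-sym : Symmetric R) (R-irrefl : ∀ {x} → P x → ¬ R x x)
                     (m : ℕ) where

    record Collection : Set where
      constructor mkCollection
      field
        members   : List A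
        .sorted   : StrictlySorted members
        .size     : length members ≡ m
        .all      : All P members
        .pairwise : AllPairs R members

    record Family : Set where
      constructor mkFamily
      field
        entries   : Vec A m
        .all      : ∀ i → P (lookup entries i)
        .pairwise : ∀ i j → i ≢ j → R (lookup entries i) (lookup entries j)

    Collection-≡ : ∀ {c c′ : Collection} → Collection.members c ≡ Collection.members c′ → c ≡ c′
    Collection-≡ refl = refl

    Family-≡ : ∀ {f f′ : Family} → Family.entries f ≡ Family.entries f′ → f ≡ f′
    Family-≡ refl = refl

    pairwise⇒injective : ∀ (v : Vec A m) → (∀ i → P (lookup v i)) →
                         (∀ i j → i ≢ j → R (lookup v i) (lookup v j)) → Injective _≡_ _≡_ (lookup v)
    pairwise⇒injective v all pairwise {i} {j} vi≡vj with i ≟ j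
    ... | yes i≡j = i≡j
    ... | no  i≢j = contradiction (subst (λ x → R x (lookup v j)) vi≡vj (pairwise i j i≢j)) (R-irrefl (all j))

    pick : (xs : List A) → .(length xs ≡ m) → Fin m → A
    pick xs |xs|≡m k = List.lookup xs (cast (sym |xs|≡m) k)

    pick-cong : ∀ {xs ys} → xs ≡ ys → .(|xs|≡m : length xs ≡ m) .(|ys|≡m : length ys ≡ m) →
                ∀ k → pick xs |xs|≡m k ≡ pick ys |ys|≡m k
    pick-cong refl _ _ _ = refl

    pick-injective : ∀ {xs : List A} → Unique xs → .(|xs|≡m : length xs ≡ m) → Injective _≡_ _≡_ (pick xs |xs|≡m)
    pick-injective xs! |xs|≡m {k} {l} eq = begin
      k                                 ≡⟨ cast-involutive |xs|≡m (sym |xs|≡m) k ⟨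
      cast |xs|≡m (cast (sym |xs|≡m) k) ≡⟨ cong (cast |xs|≡m) (unique⇒lookup-injective xs! eq) ⟩
      cast |xs|≡m (cast (sym |xs|≡m) l) ≡⟨ cast-involutive |xs|≡m (sym |xs|≡m) l ⟩
      l                                 ∎
      where open ≡-Reasoning

    module _ (xs : List A) .(|xs|≡m : length xs ≡ m) where

      pick-all : All P xs → ∀ k → P (pick xs |xs|≡m k)
      pick-all all k = All.lookup all (∈-lookup _)

      pick-pairwise : StrictlySorted xs → AllPairs R xs → ∀ {k l} → k ≢ l →
                      R (pick xs |xs|≡m k) (pick xs |xs|≡m l)
      pick-pairwise xs↗ pairwise k≢l with ∈-AllPairs₂ pairwise (∈-lookup _) (∈-lookup _)
      ... | inj₁ eq       = contradiction (pick-injective (strictlySorted⇒unique xs↗) |xs|≡m eq) k≢l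
      ... | inj₂ (inj₁ r) = r
      ... | inj₂ (inj₂ r) = R-sym r

      pick-index : ∀ {x} (x∈xs : x ∈ˡ xs) → pick xs |xs|≡m (cast |xs|≡m (index x∈xs)) ≡ x
      pick-index x∈xs =
        trans (cong (List.lookup xs) (cast-involutive (sym |xs|≡m) |xs|≡m _)) (sym (lookup-index x∈xs))

      arrange : Vec (Fin m) m → Vec A m
      arrange π = tabulate (pick xs |xs|≡m ∘ lookup π)

      lookup-arrange : ∀ π i → lookup (arrange π) i ≡ pick xs |xs|≡m (lookup π i)
      lookup-arrange π = lookup∘tabulate (pick xs |xs|≡m ∘ lookup π)

    module _ (v : Vec A m) where

      sortedEntries : List A
      sortedEntries = sort (List.tabulate (lookup v))

      sortedEntries-↭ : sortedEntries ↭ List.tabulate (lookup v)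
      sortedEntries-↭ = sort-↭ (List.tabulate (lookup v))

      sortedEntries-length : length sortedEntries ≡ m
      sortedEntries-length = trans (↭-length sortedEntries-↭) (Listₚ.length-tabulate (lookup v))

      entry∈sortedEntries : ∀ i → lookup v i ∈ˡ sortedEntries
      entry∈sortedEntries i = ∈-resp-↭ (↭-sym sortedEntries-↭) (∈-tabulate⁺ i)

      rank : Fin m → Fin m
      rank i = cast sortedEntries-length (index (entry∈sortedEntries i))

      ranks : Vec (Fin m) m
      ranks = tabulate rank

      pick-rank : ∀ i → pick sortedEntries sortedEntries-length (rank i) ≡ lookup v i
      pick-rank i = pick-index sortedEntries sortedEntries-length (entry∈sortedEntries i)

      arrange-ranks : arrange sortedEntries sortedEntries-length ranks ≡ v
      arrange-ranks = tabulate-≗⇒≡ v λ i →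
        trans (cong (pick sortedEntries sortedEntries-length) (lookup∘tabulate rank i)) (pick-rank i)

      module _ (v-injective : Injective _≡_ _≡_ (lookup v)) where

        sortedEntries-unique : Unique sortedEntries
        sortedEntries-unique = Unique-resp-↭ (↭⇒↭ₛ (↭-sym sortedEntries-↭)) (Uniqueₚ.tabulate⁺ v-injective)

        ranks-injective : Injective _≡_ _≡_ (lookup ranks)
        ranks-injective = lookup-tabulate-injective λ {i} {j} eq →
          v-injective (trans (sym (pick-rank i))
                      (trans (cong (pick sortedEntries sortedEntries-length) eq) (pick-rank j)))

    unlabel : Family → Collection × FinInjection m m
    unlabel (mkFamily v all pairwise) =
      mkCollection (sortedEntries v)
        (sort-strictlySorted (Uniqueₚ.tabulate⁺ (pairwise⇒injective v all pairwise)))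
        (sortedEntries-length v)
        (All-resp-↭ (↭-sym (sortedEntries-↭ v)) (Allₚ.tabulate⁺ all))
        (AllPairs-resp-↭ R-sym (resp₂ R) (↭⇒↭ₛ (↭-sym (sortedEntries-↭ v))) (AllPairsₚ.tabulate⁺ (pairwise _ _)))
      , mkFinInjection (ranks v) (ranks-injective v (pairwise⇒injective v all pairwise))

    label : Collection × FinInjection m m → Family
    label (mkCollection xs xs↗ |xs|≡m all pairwise , mkFinInjection π π-injective) =
      mkFamily (arrange xs |xs|≡m π)
        (λ i → subst P (sym (lookup-arrange xs |xs|≡m π i)) (pick-all xs |xs|≡m all (lookup π i)))
        (λ i j i≢j → subst₂ R (sym (lookup-arrange xs |xs|≡m π i)) (sym (lookup-arrange xs |xs|≡m π j))
                       (pick-pairwise xs |xs|≡m xs↗ pairwise (i≢j ∘ π-injective)))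

    label-unlabel : ∀ f → label (unlabel f) ≡ f
    label-unlabel (mkFamily v _ _) = Family-≡ (arrange-ranks v)

    module _ {xs : List A} (xs↗ : StrictlySorted xs) (|xs|≡m : length xs ≡ m)
             (π : Vec (Fin m) m) (π-injective : Injective _≡_ _≡_ (lookup π)) where

      private
        v : Vec A m
        v = arrange xs |xs|≡m π

        v-injective : Injective _≡_ _≡_ (lookup v)
        v-injective = lookup-tabulate-injective (π-injective ∘ pick-injective (strictlySorted⇒unique xs↗) |xs|≡m)

        ∈v⇒∈xs : ∀ {x} → x ∈ˡ List.tabulate (lookup v) → x ∈ˡ xs
        ∈v⇒∈xs x∈v with i , refl ← ∈-tabulate⁻ x∈v =
          subst (_∈ˡ xs) (sym (lookup-arrange xs |xs|≡m π i)) (∈-lookup _)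

        ∈xs⇒∈v : ∀ {x} → x ∈ˡ xs → x ∈ˡ List.tabulate (lookup v)
        ∈xs⇒∈v x∈xs with i , πi≡k ← injective⇒surjective π-injective (cast |xs|≡m (index x∈xs)) =
          subst (_∈ˡ List.tabulate (lookup v)) (begin
            lookup v i                                      ≡⟨ lookup-arrange xs |xs|≡m π i ⟩
            pick xs |xs|≡m (lookup π i)                     ≡⟨ cong (pick xs |xs|≡m) πi≡k ⟩
            pick xs |xs|≡m (cast |xs|≡m (index x∈xs))       ≡⟨ pick-index xs |xs|≡m x∈xs ⟩
            _                                               ∎) (∈-tabulate⁺ i)
          where open ≡-Reasoning

      sortedEntries-arrange : sortedEntries v ≡ xs
      sortedEntries-arrange = strictlySorted-set-≡ (sort-strictlySorted (Uniqueₚ.tabulate⁺ v-injective)) xs↗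
        (mk⇔ (∈v⇒∈xs ∘ ∈-resp-↭ (sortedEntries-↭ v)) (∈-resp-↭ (↭-sym (sortedEntries-↭ v)) ∘ ∈xs⇒∈v))

      ranks-arrange : ranks v ≡ π
      ranks-arrange = tabulate-≗⇒≡ π λ i → pick-injective (sortedEntries-unique v v-injective) |ys|≡m (begin
        pick ys |ys|≡m (rank v i)     ≡⟨ pick-rank v i ⟩
        lookup v i                    ≡⟨ lookup-arrange xs |xs|≡m π i ⟩
        pick xs |xs|≡m (lookup π i)   ≡⟨ pick-cong (sym sortedEntries-arrange) |xs|≡m |ys|≡m _ ⟩
        pick ys |ys|≡m (lookup π i)   ∎)
        where
        open ≡-Reasoning
        ys = sortedEntries v
        |ys|≡m = sortedEntries-length v

    unlabel-label : ∀ c → unlabel (label c) ≡ c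
    unlabel-label (mkCollection xs xs↗ |xs|≡m _ _ , mkFinInjection π π-injective) = cong₂ _,_
      (Collection-≡ (recompute (Listₚ.≡-dec _≟ᴬ_ _ _) (sortedEntries-arrange xs↗ |xs|≡m π π-injective)))
      (FinInjection-≡ (recompute (Vecₚ.≡-dec _≟_ _ _) (ranks-arrange xs↗ |xs|≡m π π-injective)))

    Family↔Collection×FinInjection : Family ↔ (Collection × FinInjection m m)
    Family↔Collection×FinInjection = mk↔ₛ′ unlabel label unlabel-label label-unlabel

fromDecidable : {P : Pred (Fin k) ℓ} → Decidable P → Subset k
fromDecidable P? = tabulate (⌊_⌋ ∘ P?)

module _ {P : Pred (Fin k) ℓ} (P? : Decidable P) where

  ∈-fromDecidable⁺ : ∀ {x} → P x → x ∈ fromDecidable P?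
  ∈-fromDecidable⁺ {x} px = lookup⇒[]= x _ (trans (lookup∘tabulate (⌊_⌋ ∘ P?) x) ⌊P?x⌋≡true)
    where
    ⌊P?x⌋≡true : ⌊ P? x ⌋ ≡ true
    ⌊P?x⌋≡true with P? x
    ... | yes _  = refl
    ... | no ¬px = contradiction px ¬px

  ∈-fromDecidable⁻ : ∀ {x} → x ∈ fromDecidable P? → P x
  ∈-fromDecidable⁻ {x} x∈ with P? x | trans (sym (lookup∘tabulate (⌊_⌋ ∘ P?) x)) ([]=⇒lookup x∈)
  ... | yes px | _  = px
  ... | no  _  | ()

<ˡ-irrefl : {x : Subset k} → ¬ x <ˡ x
<ˡ-irrefl (there x<x) = <ˡ-irrefl x<x

<ˡ-trans : {x y z : Subset k} → x <ˡ y → y <ˡ z → x <ˡ z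
<ˡ-trans here      (there _) = here
<ˡ-trans (there _) here      = here
<ˡ-trans (there p) (there q) = there (<ˡ-trans p q)

<ˡ-there⁻¹ : ∀ {b} {x y : Subset k} → (b ∷ x) <ˡ (b ∷ y) → x <ˡ y
<ˡ-there⁻¹ (there x<y) = x<y

<ˡ-tri-∷ : ∀ {b} {x y : Subset k} → Tri (x <ˡ y) (x ≡ y) (y <ˡ x) →
           Tri ((b ∷ x) <ˡ (b ∷ y)) (b ∷ x ≡ b ∷ y) ((b ∷ y) <ˡ (b ∷ x))
<ˡ-tri-∷ (tri< x<y x≢y y≮x) = tri< (there x<y) (x≢y ∘ ∷-injectiveʳ) (y≮x ∘ <ˡ-there⁻¹)
<ˡ-tri-∷ (tri≈ x≮y refl y≮x) = tri≈ (x≮y ∘ <ˡ-there⁻¹) refl (y≮x ∘ <ˡ-there⁻¹)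
<ˡ-tri-∷ (tri> x≮y x≢y y<x) = tri> (x≮y ∘ <ˡ-there⁻¹) (x≢y ∘ ∷-injectiveʳ) (there y<x)

<ˡ-compare : Trichotomous _≡_ (_<ˡ_ {k})
<ˡ-compare []          []          = tri≈ (λ ()) refl (λ ())
<ˡ-compare (false ∷ x) (true ∷ y)  = tri< here (λ ()) (λ ())
<ˡ-compare (true ∷ x)  (false ∷ y) = tri> (λ ()) (λ ()) here
<ˡ-compare (false ∷ x) (false ∷ y) = <ˡ-tri-∷ (<ˡ-compare x y)
<ˡ-compare (true ∷ x)  (true ∷ y)  = <ˡ-tri-∷ (<ˡ-compare x y)

<ˡ-isStrictTotalOrder : IsStrictTotalOrder _≡_ (_<ˡ_ {k})
<ˡ-isStrictTotalOrder = record
  { isStrictPartialOrder = record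
    { isEquivalence = isEquivalence
    ; irrefl        = λ { refl → <ˡ-irrefl }
    ; trans         = <ˡ-trans
    ; <-resp-≈      = resp₂ _<ˡ_
    }
  ; compare = <ˡ-compare
  }

LatinSquare-≡ : ∀ {L L′ : LatinSquare k} → LatinSquare.entries L ≡ LatinSquare.entries L′ → L ≡ L′
LatinSquare-≡ refl = refl

data Spoke {N : ℕ} (c o : Fin N) : Fin N × Fin N → Set where
  outward : Spoke c o (c , o)
  inward  : Spoke c o (o , c)

module _ {N : ℕ} (c : Fin N) where

  leaf : Fin N × Fin N → Fin N
  leaf (a , b) with a ≟ c
  ... | yes _ = b
  ... | no  _ = a

  spoke : ∀ p → (proj₁ p ≡ c ⊎ proj₂ p ≡ c) → proj₁ p ≢ proj₂ p → Spoke c (leaf p) p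
  spoke (a , b) at-c _ with a ≟ c | at-c
  ... | yes refl | _         = outward
  ... | no  a≢c  | inj₁ a≡c  = contradiction a≡c a≢c
  ... | no  _    | inj₂ refl = inward

module _ {N : ℕ} {c o : Fin N} where

  spoke-leaf≢center : ∀ {p} → Spoke c o p → proj₁ p ≢ proj₂ p → o ≢ c
  spoke-leaf≢center outward c≢o = c≢o ∘ sym
  spoke-leaf≢center inward  o≢c = o≢c

  spoke-incident-leaf : ∀ {p} → Spoke c o p → proj₁ p ≡ o ⊎ proj₂ p ≡ o
  spoke-incident-leaf outward = inj₂ refl
  spoke-incident-leaf inward  = inj₁ refl

  spoke-incident : ∀ {p v} → Spoke c o p → proj₁ p ≡ v ⊎ proj₂ p ≡ v → v ≢ c → o ≡ v
  spoke-incident outward (inj₁ refl) v≢c = contradiction refl v≢c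
  spoke-incident outward (inj₂ o≡v)  _   = o≡v
  spoke-incident inward  (inj₁ o≡v)  _   = o≡v
  spoke-incident inward  (inj₂ refl) v≢c = contradiction refl v≢c

  spoke-sameEnds : ∀ {p q} → Spoke c o p → Spoke c o q → p ≡ q ⊎ p ≡ swap q
  spoke-sameEnds outward outward = inj₁ refl
  spoke-sameEnds outward inward  = inj₂ refl
  spoke-sameEnds inward  outward = inj₂ refl
  spoke-sameEnds inward  inward  = inj₁ refl

  spoke-sameEnds⁻ : ∀ {o′ p q} → Spoke c o p → Spoke c o′ q → o ≢ c → p ≡ q ⊎ p ≡ swap q → o ≡ o′
  spoke-sameEnds⁻ outward outward _   (inj₁ refl) = refl
  spoke-sameEnds⁻ outward inward  _   (inj₁ refl) = refl
  spoke-sameEnds⁻ inward  outward _   (inj₁ refl) = refl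
  spoke-sameEnds⁻ inward  inward  _   (inj₁ refl) = refl
  spoke-sameEnds⁻ outward outward o≢c (inj₂ refl) = contradiction refl o≢c
  spoke-sameEnds⁻ outward inward  _   (inj₂ refl) = refl
  spoke-sameEnds⁻ inward  outward _   (inj₂ refl) = refl
  spoke-sameEnds⁻ inward  inward  o≢c (inj₂ refl) = contradiction refl o≢c

module CommonCenter {m : ℕ} (G : Multigraph (suc (suc m))) (col : Fin (edges G) → Fin (suc m))
  (c : Fin (suc (suc m)))
  (monochromatic : ∀ i → StarAt G (ColorClass G col i) c × Spanning G (ColorClass G col i)) where

  private
    E : ℕ
    E = edges G

    RainbowSpanning : Subset E → Set
    RainbowSpanning = RainbowSpanningStar G col

    Row : Set
    Row = Vec (Fin (suc m)) (suc m)

  edge-at-center : ∀ e → Incident G c e × ¬ Loop G e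
  edge-at-center e = proj₁ (proj₁ (monochromatic (col e))) e (∈-fromDecidable⁺ (λ x → col x ≟ col e) refl)

  leafOf : Fin E → Fin (suc (suc m))
  leafOf e = leaf c (ends G e)

  edge-spoke : ∀ e → Spoke c (leafOf e) (ends G e)
  edge-spoke e = spoke c (ends G e) (proj₁ (edge-at-center e)) (proj₂ (edge-at-center e))

  leafOf≢center : ∀ e → leafOf e ≢ c
  leafOf≢center e = spoke-leaf≢center (edge-spoke e) (proj₂ (edge-at-center e))

  -- Leaves are numbered by Fin (suc m) by punching out the center; these
  -- numbers index the columns of the Latin square.
  slot : Fin E → Fin (suc m)
  slot e = punchOut (leafOf≢center e ∘ sym)

  leafOf-slot : ∀ e → punchIn c (slot e) ≡ leafOf e
  leafOf-slot e = punchIn-punchOut (leafOf≢center e ∘ sym)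

  slot-leafOf : ∀ {e j} → leafOf e ≡ punchIn c j → slot e ≡ j
  slot-leafOf eq = trans (punchOut-cong c eq) (punchOut-punchIn c)

  incident⇒slot : ∀ {e j} → Incident G (punchIn c j) e → slot e ≡ j
  incident⇒slot {e} {j} inc = slot-leafOf (spoke-incident (edge-spoke e) inc (punchInᵢ≢i c j))

  slot⇒incident : ∀ {e j} → slot e ≡ j → Incident G (punchIn c j) e
  slot⇒incident {e} refl =
    subst (λ v → Incident G v e) (sym (leafOf-slot e)) (spoke-incident-leaf (edge-spoke e))

  sameSlot⇒sameEnds : ∀ {e e′} → slot e ≡ slot e′ → SameEnds G e e′
  sameSlot⇒sameEnds {e} {e′} eq =
    spoke-sameEnds (edge-spoke e) (subst (λ o → Spoke c o (ends G e′)) same-leaf (edge-spoke e′))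
    where
    same-leaf : leafOf e′ ≡ leafOf e
    same-leaf = trans (sym (leafOf-slot e′)) (trans (cong (punchIn c) (sym eq)) (leafOf-slot e))

  sameEnds⇒sameSlot : ∀ {e e′} → SameEnds G e e′ → slot e ≡ slot e′
  sameEnds⇒sameSlot {e} {e′} same = slot-leafOf
    (trans (spoke-sameEnds⁻ (edge-spoke e) (edge-spoke e′) (leafOf≢center e) same) (sym (leafOf-slot e′)))

  edge-unique : ∀ {e e′} → col e ≡ col e′ → slot e ≡ slot e′ → e ≡ e′
  edge-unique {e} {e′} col≡ slot≡ = proj₂ (proj₁ (monochromatic (col e))) e e′
    (∈-fromDecidable⁺ (λ x → col x ≟ col e) refl) (∈-fromDecidable⁺ (λ x → col x ≟ col e) (sym col≡))
    (sameSlot⇒sameEnds slot≡)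

  edge-exists : ∀ j s → ∃[ e ] slot e ≡ j × col e ≡ s
  edge-exists j s with e , e∈ , inc ← proj₂ (monochromatic s) (punchIn c j) =
    e , incident⇒slot inc , ∈-fromDecidable⁻ (λ x → col x ≟ s) e∈

  spanning⇒slot : ∀ {S} → Spanning G S → ∀ j → ∃[ e ] e ∈ S × slot e ≡ j
  spanning⇒slot span j with e , e∈S , inc ← span (punchIn c j) = e , e∈S , incident⇒slot inc

  star⇒slot-injective : ∀ {S} → IsStar G S → ∀ {e e′} → e ∈ S → e′ ∈ S → slot e ≡ slot e′ → e ≡ e′
  star⇒slot-injective (_ , _ , simple) {e} {e′} e∈S e′∈S eq = simple e e′ e∈S e′∈S (sameSlot⇒sameEnds eq)

  rowStar : Row → Subset E
  rowStar ρ = fromDecidable (λ e → col e ≟ lookup ρ (slot e))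

  ∈-rowStar⁺ : ∀ ρ {e} → col e ≡ lookup ρ (slot e) → e ∈ rowStar ρ
  ∈-rowStar⁺ ρ = ∈-fromDecidable⁺ (λ e → col e ≟ lookup ρ (slot e))

  ∈-rowStar⁻ : ∀ ρ {e} → e ∈ rowStar ρ → col e ≡ lookup ρ (slot e)
  ∈-rowStar⁻ ρ = ∈-fromDecidable⁻ (λ e → col e ≟ lookup ρ (slot e))

  colorAt : Subset E → Fin (suc m) → Fin (suc m)
  colorAt S j with any? (λ e → (e ∈? S) ×-dec (slot e ≟ j))
  ... | yes (e , _) = col e
  ... | no  _       = zero  -- junk: S has no edge in slot j

  colorAt-spec : ∀ {S j} → (∃[ e ] e ∈ S × slot e ≡ j) → ∃[ e ] (e ∈ S × slot e ≡ j) × colorAt S j ≡ col e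
  colorAt-spec {S} {j} found with any? (λ e → (e ∈? S) ×-dec (slot e ≟ j))
  ... | yes (e , e∈S×slot) = e , e∈S×slot , refl
  ... | no  none           = contradiction found none

  starRow : Subset E → Row
  starRow S = tabulate (colorAt S)

  starRow-star : ∀ {S e} → IsStar G S → e ∈ S → lookup (starRow S) (slot e) ≡ col e
  starRow-star {S} {e} star e∈S with e′ , (e′∈S , slot≡) , eq ← colorAt-spec (_ , e∈S , refl) =
    trans (lookup∘tabulate (colorAt S) (slot e)) (trans eq (cong col (star⇒slot-injective star e′∈S e∈S slot≡)))

  lookup-starRow : ∀ {S} → RainbowSpanning S → ∀ j → ∃[ e ] e ∈ S × slot e ≡ j × lookup (starRow S) j ≡ col e
  lookup-starRow (star , span , _) j with e , e∈S , refl ← spanning⇒slot span j =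
    e , e∈S , refl , starRow-star star e∈S

  rowStar-slot : ∀ ρ j → ∃[ e ] e ∈ rowStar ρ × slot e ≡ j
  rowStar-slot ρ j with e , slot≡ , col≡ ← edge-exists j (lookup ρ j) =
    e , ∈-rowStar⁺ ρ (trans col≡ (cong (lookup ρ) (sym slot≡))) , slot≡

  starRow-rowStar : ∀ ρ → starRow (rowStar ρ) ≡ ρ
  starRow-rowStar ρ = tabulate-≗⇒≡ ρ λ j →
    let e , (e∈ , slot≡) , eq = colorAt-spec (rowStar-slot ρ j)
    in trans eq (trans (∈-rowStar⁻ ρ e∈) (cong (lookup ρ) slot≡))

  rowStar-starRow : ∀ {S} → RainbowSpanning S → rowStar (starRow S) ≡ S
  rowStar-starRow {S} (star , span , _) = ⊆-antisym ⊆S S⊆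
    where
    ⊆S : ∀ {e} → e ∈ rowStar (starRow S) → e ∈ S
    ⊆S {e} e∈ with e′ , e′∈S , slot≡ ← spanning⇒slot span (slot e) =
      subst (_∈ S) (edge-unique col≡ slot≡) e′∈S
      where
      col≡ : col e′ ≡ col e
      col≡ = trans (sym (starRow-star star e′∈S))
                   (trans (cong (lookup (starRow S)) slot≡) (sym (∈-rowStar⁻ (starRow S) e∈)))
    S⊆ : ∀ {e} → e ∈ S → e ∈ rowStar (starRow S)
    S⊆ e∈S = ∈-rowStar⁺ (starRow S) (sym (starRow-star star e∈S))

  rowStar-rainbowSpanning : ∀ ρ → Injective _≡_ _≡_ (lookup ρ) → RainbowSpanning (rowStar ρ)
  rowStar-rainbowSpanning ρ ρ-injective = (c , (λ e _ → edge-at-center e) , simple) , spanning , rainbow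
    where
    simple : ∀ e e′ → e ∈ rowStar ρ → e′ ∈ rowStar ρ → SameEnds G e e′ → e ≡ e′
    simple e e′ e∈ e′∈ same = edge-unique
      (trans (∈-rowStar⁻ ρ e∈) (trans (cong (lookup ρ) (sameEnds⇒sameSlot same)) (sym (∈-rowStar⁻ ρ e′∈))))
      (sameEnds⇒sameSlot same)
    spanning : Spanning G (rowStar ρ)
    spanning v with v ≟ c
    ... | yes refl with e , e∈ , _ ← rowStar-slot ρ zero = e , e∈ , proj₁ (edge-at-center e)
    spanning v | no v≢c with e , e∈ , slot≡ ← rowStar-slot ρ (punchOut (v≢c ∘ sym)) =
      e , e∈ , subst (λ w → Incident G w e) (punchIn-punchOut (v≢c ∘ sym)) (slot⇒incident slot≡)
    rainbow : Rainbow G col (rowStar ρ)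
    rainbow e e′ e∈ e′∈ col≡ = edge-unique col≡
      (ρ-injective (trans (sym (∈-rowStar⁻ ρ e∈)) (trans col≡ (∈-rowStar⁻ ρ e′∈))))

  starRow-injective : ∀ {S} → RainbowSpanning S → Injective _≡_ _≡_ (lookup (starRow S))
  starRow-injective rs@(_ , _ , rainbow) {j} {j′} eq
    with e , e∈S , refl , eqj ← lookup-starRow rs j | e′ , e′∈S , refl , eqj′ ← lookup-starRow rs j′ =
    cong slot (rainbow e e′ e∈S e′∈S (trans (sym eqj) (trans eq eqj′)))

  rowStar-disjoint : ∀ ρ ρ′ → (∀ j → lookup ρ j ≢ lookup ρ′ j) → Disjoint (rowStar ρ) (rowStar ρ′)
  rowStar-disjoint ρ ρ′ apart e e∈ e∈′ = apart (slot e) (trans (sym (∈-rowStar⁻ ρ e∈)) (∈-rowStar⁻ ρ′ e∈′))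

  starRow-apart : ∀ {S S′} → RainbowSpanning S → RainbowSpanning S′ → Disjoint S S′ →
                  ∀ j → lookup (starRow S) j ≢ lookup (starRow S′) j
  starRow-apart rs rs′ disjoint j eq
    with e , e∈S , slot≡ , eqj ← lookup-starRow rs j | e′ , e′∈S′ , slot≡′ , eqj′ ← lookup-starRow rs′ j =
    disjoint e e∈S (subst (_∈ _) (edge-unique (trans (sym eqj′) (trans (sym eq) eqj)) (trans slot≡′ (sym slot≡))) e′∈S′)

  rainbowSpanning-nonempty : ∀ {S} → RainbowSpanning S → ¬ Disjoint S S
  rainbowSpanning-nonempty (_ , span , _) disjoint with e , e∈S , _ ← span c = disjoint e e∈S e∈S

  Disjoint-sym : ∀ {S S′ : Subset E} → Disjoint S S′ → Disjoint S′ S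
  Disjoint-sym disjoint e e∈S′ e∈S = disjoint e e∈S e∈S′

  open SortedLists (<ˡ-isStrictTotalOrder {E}) using (module Unlabelling)
  open Unlabelling RainbowSpanning Disjoint Disjoint-sym rainbowSpanning-nonempty (suc m) public

  rowStars : Vec Row (suc m) → Vec (Subset E) (suc m)
  rowStars M = tabulate (rowStar ∘ lookup M)

  starRows : Vec (Subset E) (suc m) → Vec Row (suc m)
  starRows f = tabulate (starRow ∘ lookup f)

  rowStars-rainbowSpanning : ∀ M → IsLatin M → ∀ i → RainbowSpanning (lookup (rowStars M) i)
  rowStars-rainbowSpanning M (rows , _) i = subst RainbowSpanning (sym (lookup∘tabulate (rowStar ∘ lookup M) i))
    (rowStar-rainbowSpanning (lookup M i) (∃!⇒injective (rows i)))

  rowStars-disjoint : ∀ M → IsLatin M → ∀ i i′ → i ≢ i′ → Disjoint (lookup (rowStars M) i) (lookup (rowStars M) i′)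
  rowStars-disjoint M (_ , columns) i i′ i≢i′ =
    subst₂ Disjoint (sym (lookup∘tabulate (rowStar ∘ lookup M) i)) (sym (lookup∘tabulate (rowStar ∘ lookup M) i′))
      (rowStar-disjoint (lookup M i) (lookup M i′) λ j eq → i≢i′ (∃!⇒injective (columns j) eq))

  starRows-latin : ∀ f → (∀ i → RainbowSpanning (lookup f i)) →
                   (∀ i i′ → i ≢ i′ → Disjoint (lookup f i) (lookup f i′)) → IsLatin (starRows f)
  starRows-latin f all pairwise = injective⇒∃! ∘ row-injective , injective⇒∃! ∘ column-injective
    where
    entry : ∀ i j → lookup (lookup (starRows f) i) j ≡ lookup (starRow (lookup f i)) j
    entry i j = cong (λ ρ → lookup ρ j) (lookup∘tabulate (starRow ∘ lookup f) i)
    row-injective : ∀ i → Injective _≡_ _≡_ (lookup (lookup (starRows f) i))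
    row-injective i {j} {j′} eq = starRow-injective (all i) (trans (sym (entry i j)) (trans eq (entry i j′)))
    column-injective : ∀ j → Injective _≡_ _≡_ (λ i → lookup (lookup (starRows f) i) j)
    column-injective j {i} {i′} eq with i ≟ i′
    ... | yes i≡i′ = i≡i′
    ... | no  i≢i′ = contradiction (trans (sym (entry i j)) (trans eq (entry i′ j)))
                       (starRow-apart (all i) (all i′) (pairwise i i′ i≢i′) j)

  rowStars-starRows : ∀ f → (∀ i → RainbowSpanning (lookup f i)) → rowStars (starRows f) ≡ f
  rowStars-starRows f all = tabulate-≗⇒≡ f λ i →
    trans (cong rowStar (lookup∘tabulate (starRow ∘ lookup f) i)) (rowStar-starRow (all i))

  starRows-rowStars : ∀ M → starRows (rowStars M) ≡ M
  starRows-rowStars M = tabulate-≗⇒≡ M λ i →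
    trans (cong starRow (lookup∘tabulate (rowStar ∘ lookup M) i)) (starRow-rowStar (lookup M i))

  LatinSquare↔Family : LatinSquare (suc m) ↔ Family
  LatinSquare↔Family = mk↔ₛ′ toFamily toLatinSquare toFamily∘toLatinSquare toLatinSquare∘toFamily
    where
    toFamily : LatinSquare (suc m) → Family
    toFamily record { entries = M ; latin = latin } =
      mkFamily (rowStars M) (rowStars-rainbowSpanning M latin) (rowStars-disjoint M latin)
    toLatinSquare : Family → LatinSquare (suc m)
    toLatinSquare (mkFamily f all pairwise) =
      record { entries = starRows f ; latin = starRows-latin f all pairwise }
    toFamily∘toLatinSquare : ∀ f → toFamily (toLatinSquare f) ≡ f
    toFamily∘toLatinSquare (mkFamily f all _) =
      Family-≡ (recompute (Vecₚ.≡-dec (Vecₚ.≡-dec Boolₚ._≟_) _ _) (rowStars-starRows f all))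
    toLatinSquare∘toFamily : ∀ L → toLatinSquare (toFamily L) ≡ L
    toLatinSquare∘toFamily record { entries = M } = LatinSquare-≡ (starRows-rowStars M)

  RainbowStarCollection↔Collection : RainbowStarCollection G col ↔ Collection
  RainbowStarCollection↔Collection = mk↔ₛ′
    (λ { record { stars = s ; sorted = s↗ ; size = |s| ; rainbow = r ; disjoint = d } → mkCollection s s↗ |s| r d })
    (λ { (mkCollection s s↗ |s| r d) → record { stars = s ; sorted = s↗ ; size = |s| ; rainbow = r ; disjoint = d } })
    (λ _ → refl) (λ _ → refl)

theorem3p5 : (n : ℕ) → 2 ≤ n → (G : Multigraph n) →
    (col : Fin (edges G) → Fin (n ∸ 1)) →
    MonoStarsCommonCenter G col →
    (k L : ℕ) → (RainbowStarCollection G col ↔ Fin k) →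
    (LatinSquare (n ∸ 1) ↔ Fin L) →
    k * (n ∸ 1) ! ≡ L
theorem3p5 (suc (suc m)) (s≤s (s≤s z≤n)) G col (c , monochromatic) k L collections↔k latinSquares↔L =
  ↔⇒≡ (begin
    Fin (k * suc m !)                                            ↔⟨ *↔× ⟩
    (Fin k × Fin (suc m !))                                      ↔⟨ collections↔k ×-↔ FinInjection↔Fin[n!] (suc m) ⟨
    (RainbowStarCollection G col × FinInjection (suc m) (suc m)) ↔⟨ RainbowStarCollection↔Collection ×-↔ ↔-refl ⟩
    (Collection × FinInjection (suc m) (suc m))                  ↔⟨ Family↔Collection×FinInjection ⟨
    Family                                                       ↔⟨ LatinSquare↔Family ⟨
    LatinSquare (suc m)                                          ↔⟨ latinSquares↔L ⟩
    Fin L                                                        ∎)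
  where
  open CommonCenter G col c monochromatic
  open EquationalReasoning
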